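{- Let $\varphi$ be an $\mathsf{SCI}$-formula, $\mathbf{w}^-\in\mathsf{L}^-$, and let $\mathcal{B}$ be an open and fully expanded branch of a $\mathsf{TC}_{\mathsf{SCI}}$-tableau with $\mathbf{w}^-:\varphi$ at its root. Let $\mathsf{L}_{\mathcal{B}}$ be the set of labels $w$ such that $w:\psi$ occurs on $\mathcal{B}$ for some formula $\psi$, $\mathsf{L}_{\mathcal{B}}^+=\mathsf{L}_{\mathcal{B}}\cap\mathsf{L}^+$, $\mathsf{L}_{\mathcal{B}}^-=\mathsf{L}_{\mathcal{B}}\cap\mathsf{L}^-$, and define $\sim\subseteq\mathsf{L}_{\mathcal{B}}\times\mathsf{L}_{\mathcal{B}}$ by $w\sim v$ iff the equality statement $w=v$ occurs on $\mathcal{B}$. Then $\sim$ is an equivalence relation on $\mathsf{L}_{\mathcal{B}}$ and $(\mathsf{L}_{\mathcal{B}}^+\times\mathsf{L}_{\mathcal{B}}^-)\cap{\sim}=\emptyset$.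
   Context: SCI-formulas: over a countably infinite set $\mathsf{AF}$ of atoms, $\varphi ::= p \mid \neg\varphi \mid \varphi\to\varphi \mid \varphi\equiv\varphi$. Tableau system $\mathsf{TC}_{\mathsf{SCI}}$. Let $\mathsf{L}^+,\mathsf{L}^-$ be disjoint countably infinite sets of labels, $\mathsf{L}=\mathsf{L}^+\cup\mathsf{L}^-$; a label written $w^+$ lies in $\mathsf{L}^+$, $w^-$ in $\mathsf{L}^-$, an unsuperscripted label is arbitrary. A labelled formula is $w:\varphi$. Equality statements $w=v$ and inequality statements $w\neq v$ may also occur. A tableau is a tree whose nodes carry labelled formulas, (in)equality statements or $\bot$; a branch is a root-to-leaf path, identified with the set of items on it. Rules (premises / alternative conclusion sets separated by $\mid$): Decomposition rules (all labels in the conclusions are fresh on the branch): $(\neg^+)$ $w^+:\neg\varphi$ / $v^-:\varphi$; $(\neg^-)$ $w^-:\neg\varphi$ / $v^+:\varphi$; $(\to^+)$ $w^+:\varphi\to\psi$ / $\{v^-:\varphi,u^-:\psi\}\mid\{v^-:\varphi,u^+:\psi\}\mid\{v^+:\varphi,u^+:\psi\}$; $(\to^-)$ $w^-:\varphi\to\psi$ / $\{v^+:\varphi,u^-:\psi\}$; $(\equiv^+)$ $w^+:\varphi\equiv\psi$ / $\{v^+:\varphi,u^+:\psi,v^+=u^+\}\mid\{v^-:\varphi,u^-:\psi,v^-=u^-\}$; $(\equiv^-)$ $w^-:\varphi\equiv\psi$ / $\{v^+:\varphi,u^+:\psi,v^+\neq u^+\}\mid\{v^+:\varphi,u^-:\psi\}\mid\{v^-:\varphi,u^+:\psi\}\mid\{v^-:\varphi,u^-:\psi,v^-\neq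 u^-\}$. Equality rules, where $\varphi\approx\psi$ abbreviates the three premises $w:\varphi$, $v:\psi$, $w=v$ for some labels $w,v$: $(\equiv^\neg)$ $\varphi\approx\psi$, $u:\neg\varphi$, $y:\neg\psi$ / $u=y$; $(\equiv^\to)$ $\varphi\approx\psi$, $\chi\approx\theta$, $x:\varphi\to\chi$, $z:\psi\to\theta$ / $x=z$; $(\equiv^\equiv)$ $\varphi\approx\psi$, $\chi\approx\theta$, $x:\varphi\equiv\chi$, $z:\psi\equiv\theta$ / $x=z$; $(\mathsf F)$ $w:\varphi$, $v:\varphi$ / $w=v$ (the two premises may coincide); $(\mathsf{sym})$ $w=v$ / $v=w$; $(\mathsf{tran})$ $w=v$, $v=u$ / $w=u$. Closure rules: $(\bot_1)$ $w=v$, $w\neq v$ / $\bot$; $(\bot_2)$ $w^+=v^-$ / $\bot$. A decomposition rule may be applied to $w:\varphi$ on a branch only if it has not been applied to $w:\varphi$ there before; an equality rule may be applied only if its conclusion is not already on the branch; closure rules are applied eagerly. A branch is closed if a closure rule has been applied on it, open otherwise; it is fully expanded if it is closed or no rule is applicable on it. -}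

module Defs where

open import Data.Nat using (ℕ)
open import Data.Product using (Σ; ∃; ∃-syntax; _×_; _,_; proj₁)
open import Data.Sum using (_⊎_)
open import Data.List using (List; []; _∷_; _++_; [_])
open import Data.List.Membership.Propositional using (_∈_; _∉_)
open import Data.List.Relation.Unary.All using (All)
open import Data.List.Relation.Unary.Unique.Propositional using (Unique)
open import Relation.Nullary using (¬_)
open import Relation.Binary.PropositionalEquality using (_≡_)

data Fm : Set where
  atom : ℕ → Fm
  ¬'_  : Fm → Fm
  _⇒_  : Fm → Fm → Fm
  _≡'_ : Fm → Fm → Fm

-- Labels: L⁺ = {pos} × ℕ, L⁻ = {neg} × ℕ (disjoint, countably infinite)

data Sign : Set where
  pos neg : Sign

Label : Set
Label = Sign × ℕ

sign : Label → Sign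
sign = proj₁

data Item : Set where
  _∶_  : Label → Fm → Item
  _≐_  : Label → Label → Item
  _≉_  : Label → Label → Item
  ⊥̇    : Item

labelsOf : Item → List Label
labelsOf (w ∶ _) = w ∷ []
labelsOf (w ≐ v) = w ∷ v ∷ []
labelsOf (w ≉ v) = w ∷ v ∷ []
labelsOf ⊥̇       = []

Fresh : List Item → Label → Set
Fresh B l = ∀ {i} → i ∈ B → l ∉ labelsOf i

-- Decomposition rules.  DecConc w φ ls C : C is one of the alternative
-- conclusion sets of the decomposition rule for w : φ, where ls lists the
-- (to be fresh) labels introduced in C.

data DecConc : Label → Fm → List Label → List Item → Set where
  ¬⁺  : ∀ {n φ} (a : ℕ) →
        DecConc (pos , n) (¬' φ) ((neg , a) ∷ [])
                [ (neg , a) ∶ φ ]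
  ¬⁻  : ∀ {n φ} (a : ℕ) →
        DecConc (neg , n) (¬' φ) ((pos , a) ∷ [])
                [ (pos , a) ∶ φ ]
  ⇒⁺₁ : ∀ {n φ ψ} (a b : ℕ) →
        DecConc (pos , n) (φ ⇒ ψ) ((neg , a) ∷ (neg , b) ∷ [])
                ((neg , a) ∶ φ ∷ (neg , b) ∶ ψ ∷ [])
  ⇒⁺₂ : ∀ {n φ ψ} (a b : ℕ) →
        DecConc (pos , n) (φ ⇒ ψ) ((neg , a) ∷ (pos , b) ∷ [])
                ((neg , a) ∶ φ ∷ (pos , b) ∶ ψ ∷ [])
  ⇒⁺₃ : ∀ {n φ ψ} (a b : ℕ) →
        DecConc (pos , n) (φ ⇒ ψ) ((pos , a) ∷ (pos , b) ∷ [])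
                ((pos , a) ∶ φ ∷ (pos , b) ∶ ψ ∷ [])
  ⇒⁻  : ∀ {n φ ψ} (a b : ℕ) →
        DecConc (neg , n) (φ ⇒ ψ) ((pos , a) ∷ (neg , b) ∷ [])
                ((pos , a) ∶ φ ∷ (neg , b) ∶ ψ ∷ [])
  ≡⁺₁ : ∀ {n φ ψ} (a b : ℕ) →
        DecConc (pos , n) (φ ≡' ψ) ((pos , a) ∷ (pos , b) ∷ [])
                ((pos , a) ∶ φ ∷ (pos , b) ∶ ψ ∷ ((pos , a) ≐ (pos , b)) ∷ [])
  ≡⁺₂ : ∀ {n φ ψ} (a b : ℕ) →
        DecConc (pos , n) (φ ≡' ψ) ((neg , a) ∷ (neg , b) ∷ [])
                ((neg , a) ∶ φ ∷ (neg , b) ∶ ψ ∷ ((neg , a) ≐ (neg , b)) ∷ [])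
  ≡⁻₁ : ∀ {n φ ψ} (a b : ℕ) →
        DecConc (neg , n) (φ ≡' ψ) ((pos , a) ∷ (pos , b) ∷ [])
                ((pos , a) ∶ φ ∷ (pos , b) ∶ ψ ∷ ((pos , a) ≉ (pos , b)) ∷ [])
  ≡⁻₂ : ∀ {n φ ψ} (a b : ℕ) →
        DecConc (neg , n) (φ ≡' ψ) ((pos , a) ∷ (neg , b) ∷ [])
                ((pos , a) ∶ φ ∷ (neg , b) ∶ ψ ∷ [])
  ≡⁻₃ : ∀ {n φ ψ} (a b : ℕ) →
        DecConc (neg , n) (φ ≡' ψ) ((neg , a) ∷ (pos , b) ∷ [])
                ((neg , a) ∶ φ ∷ (pos , b) ∶ ψ ∷ [])
  ≡⁻₄ : ∀ {n φ ψ} (a b : ℕ) →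
        DecConc (neg , n) (φ ≡' ψ) ((neg , a) ∷ (neg , b) ∷ [])
                ((neg , a) ∶ φ ∷ (neg , b) ∶ ψ ∷ ((neg , a) ≉ (neg , b)) ∷ [])

_≈[_]_ : Fm → List Item → Fm → Set
φ ≈[ B ] ψ = ∃[ w ] ∃[ v ] ((w ∶ φ) ∈ B × (v ∶ ψ) ∈ B × (w ≐ v) ∈ B)

data EqRule (B : List Item) : Item → Set where
  ≡¬    : ∀ {φ ψ u y} → φ ≈[ B ] ψ →
          (u ∶ (¬' φ)) ∈ B → (y ∶ (¬' ψ)) ∈ B → EqRule B (u ≐ y)
  ≡⇒    : ∀ {φ ψ χ θ x z} → φ ≈[ B ] ψ → χ ≈[ B ] θ →
          (x ∶ (φ ⇒ χ)) ∈ B → (z ∶ (ψ ⇒ θ)) ∈ B → EqRule B (x ≐ z)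
  ≡≡    : ∀ {φ ψ χ θ x z} → φ ≈[ B ] ψ → χ ≈[ B ] θ →
          (x ∶ (φ ≡' χ)) ∈ B → (z ∶ (ψ ≡' θ)) ∈ B → EqRule B (x ≐ z)
  F     : ∀ {φ w v} → (w ∶ φ) ∈ B → (v ∶ φ) ∈ B → EqRule B (w ≐ v)
  symR  : ∀ {w v} → (w ≐ v) ∈ B → EqRule B (v ≐ w)
  tranR : ∀ {w v u} → (w ≐ v) ∈ B → (v ≐ u) ∈ B → EqRule B (w ≐ u)

ClosurePremise : List Item → Set
ClosurePremise B =
  (∃[ w ] ∃[ v ] ((w ≐ v) ∈ B × (w ≉ v) ∈ B))
  ⊎ (∃[ n ] ∃[ m ] (((pos , n) ≐ (neg , m)) ∈ B))

-- Stage of a branch under construction: the items on it, and the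
-- labelled formulas to which a decomposition rule has already been applied.

record Stage : Set where
  constructor stage
  field
    items : List Item
    done  : List (Label × Fm)
open Stage public

-- One rule application extending a branch.  Closure rules are applied
-- eagerly: other rules may only be applied when no closure rule is applicable.
data Step : Stage → Stage → Set where
  decomp : ∀ {B D w φ ls C} →
           (w ∶ φ) ∈ B → (w , φ) ∉ D →
           DecConc w φ ls C → All (Fresh B) ls → Unique ls →
           ¬ ClosurePremise B →
           Step (stage B D) (stage (C ++ B) ((w , φ) ∷ D))
  equality : ∀ {B D c} → EqRule B c → c ∉ B →
           ¬ ClosurePremise B →
           Step (stage B D) (stage (c ∷ B) D)
  closure : ∀ {B D} → ClosurePremise B →
           Step (stage B D) (stage (⊥̇ ∷ B) D)

data Branch (w : Label) (φ : Fm) : Stage → Set where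
  root : Branch w φ (stage [ w ∶ φ ] [])
  step : ∀ {s t} → Branch w φ s → Step s t → Branch w φ t

Closed Open FullyExpanded : Stage → Set
Closed s = ⊥̇ ∈ items s
Open s = ¬ Closed s
FullyExpanded s = Closed s ⊎ (¬ (∃[ t ] Step s t))

InL : List Item → Label → Set
InL B w = ∃[ ψ ] ((w ∶ ψ) ∈ B)

LB : List Item → Set
LB B = Σ Label (InL B)

Sim : (B : List Item) → LB B → LB B → Set
Sim B x y = (proj₁ x ≐ proj₁ y) ∈ B

{-# OPTIONS --safe #-}
-- Every condition in the statement is the premise of some rule: reflexivity,
-- symmetry and transitivity of ∼ are the conclusions of (F), (sym) and
-- (tran), and an equality between a positive and a negative label is the
-- premise of (⊥₂).  On an open, fully expanded branch no rule applies, so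
-- every equality rule has its conclusion already present and no closure
-- premise occurs.  Turning "the conclusion is not absent" into "the
-- conclusion is present" is where decidable equality of items is needed.
module Submission where

open import Defs
open import Data.Nat using (ℕ)
open import Data.Nat.Properties using () renaming (_≟_ to _≟ℕ_)
open import Data.Product using (_×_; _,_; proj₁; ∃-syntax)
open import Data.Product.Properties using (≡-dec)
open import Data.Sum using (inj₁; inj₂)
open import Data.Empty using (⊥-elim)
open import Data.List.Membership.Propositional using (_∈_)
import Data.List.Membership.DecPropositional as DecMembership
open import Relation.Nullary using (¬_; Dec; yes; no)
open import Relation.Nullary.Decidable using (map′; _×-dec_)
open import Relation.Binary.PropositionalEquality using (_≡_; refl; cong)
open import Relation.Binary.Structures using (IsEquivalence)
open import Relation.Binary.Definitions using (DecidableEquality)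

cong-dec : {A B : Set} (f : A → B) {a b : A} →
           (f a ≡ f b → a ≡ b) → Dec (a ≡ b) → Dec (f a ≡ f b)
cong-dec f inj = map′ (cong f) inj

cong₂-dec : {A B C : Set} (f : A → B → C) {a c : A} {b d : B} →
            (f a b ≡ f c d → a ≡ c × b ≡ d) →
            Dec (a ≡ c) → Dec (b ≡ d) → Dec (f a b ≡ f c d)
cong₂-dec f inj a? b? = map′ (λ { (refl , refl) → refl }) inj (a? ×-dec b?)

_≟Fm_ : DecidableEquality Fm
atom a   ≟Fm atom b   = cong-dec atom (λ { refl → refl }) (a ≟ℕ b)
(¬' φ)   ≟Fm (¬' ψ)   = cong-dec ¬'_ (λ { refl → refl }) (φ ≟Fm ψ)
(φ ⇒ χ)  ≟Fm (ψ ⇒ θ)  = cong₂-dec _⇒_ (λ { refl → refl , refl }) (φ ≟Fm ψ) (χ ≟Fm θ)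
(φ ≡' χ) ≟Fm (ψ ≡' θ) = cong₂-dec _≡'_ (λ { refl → refl , refl }) (φ ≟Fm ψ) (χ ≟Fm θ)
atom _   ≟Fm (¬' _)   = no λ ()
atom _   ≟Fm (_ ⇒ _)  = no λ ()
atom _   ≟Fm (_ ≡' _) = no λ ()
(¬' _)   ≟Fm atom _   = no λ ()
(¬' _)   ≟Fm (_ ⇒ _)  = no λ ()
(¬' _)   ≟Fm (_ ≡' _) = no λ ()
(_ ⇒ _)  ≟Fm atom _   = no λ ()
(_ ⇒ _)  ≟Fm (¬' _)   = no λ ()
(_ ⇒ _)  ≟Fm (_ ≡' _) = no λ ()
(_ ≡' _) ≟Fm atom _   = no λ ()
(_ ≡' _) ≟Fm (¬' _)   = no λ ()
(_ ≡' _) ≟Fm (_ ⇒ _)  = no λ ()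

_≟Sign_ : DecidableEquality Sign
pos ≟Sign pos = yes refl
neg ≟Sign neg = yes refl
pos ≟Sign neg = no λ ()
neg ≟Sign pos = no λ ()

_≟Label_ : DecidableEquality Label
_≟Label_ = ≡-dec _≟Sign_ _≟ℕ_

_≟Item_ : DecidableEquality Item
(w ∶ φ) ≟Item (v ∶ ψ) = cong₂-dec _∶_ (λ { refl → refl , refl }) (w ≟Label v) (φ ≟Fm ψ)
(w ≐ u) ≟Item (v ≐ y) = cong₂-dec _≐_ (λ { refl → refl , refl }) (w ≟Label v) (u ≟Label y)
(w ≉ u) ≟Item (v ≉ y) = cong₂-dec _≉_ (λ { refl → refl , refl }) (w ≟Label v) (u ≟Label y)
⊥̇       ≟Item ⊥̇       = yes refl
(_ ∶ _) ≟Item (_ ≐ _) = no λ ()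
(_ ∶ _) ≟Item (_ ≉ _) = no λ ()
(_ ∶ _) ≟Item ⊥̇       = no λ ()
(_ ≐ _) ≟Item (_ ∶ _) = no λ ()
(_ ≐ _) ≟Item (_ ≉ _) = no λ ()
(_ ≐ _) ≟Item ⊥̇       = no λ ()
(_ ≉ _) ≟Item (_ ∶ _) = no λ ()
(_ ≉ _) ≟Item (_ ≐ _) = no λ ()
(_ ≉ _) ≟Item ⊥̇       = no λ ()
⊥̇       ≟Item (_ ∶ _) = no λ ()
⊥̇       ≟Item (_ ≐ _) = no λ ()
⊥̇       ≟Item (_ ≉ _) = no λ ()

open DecMembership _≟Item_ using (_∈?_)

Terminal : Stage → Set
Terminal s = ¬ (∃[ t ] Step s t)

terminal⇒¬closurePremise : ∀ {s} → Terminal s → ¬ ClosurePremise (items s)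
terminal⇒¬closurePremise term cp = term (_ , closure cp)

terminal⇒eqRule-closed : ∀ {s c} → Terminal s → EqRule (items s) c → c ∈ items s
terminal⇒eqRule-closed {s} {c} term rule with c ∈? items s
... | yes c∈s = c∈s
... | no  c∉s = ⊥-elim (term (_ , equality rule c∉s (terminal⇒¬closurePremise term)))

Sim-isEquivalence : ∀ {B} → (∀ {c} → EqRule B c → c ∈ B) → IsEquivalence (Sim B)
Sim-isEquivalence closed = record
  { refl  = λ { {_ , _ , w∶ψ} → closed (F w∶ψ w∶ψ) }
  ; sym   = λ w=v → closed (symR w=v)
  ; trans = λ w=v v=u → closed (tranR w=v v=u)
  }

Sim-pos-neg-disjoint : ∀ {B} → ¬ ClosurePremise B → (x y : LB B) →
                       sign (proj₁ x) ≡ pos → sign (proj₁ y) ≡ neg → ¬ Sim B x y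
Sim-pos-neg-disjoint noClosure ((pos , a) , _) ((neg , b) , _) refl refl a=b =
  noClosure (inj₂ (a , b , a=b))

-- The branch hypothesis is not needed: openness and full expansion suffice.
proposition4 : (φ : Fm) (n : ℕ) (s : Stage) → Branch (neg , n) φ s → Open s → FullyExpanded s →
    IsEquivalence (Sim (items s))
    × (∀ (x y : LB (items s)) → sign (proj₁ x) ≡ pos → sign (proj₁ y) ≡ neg → ¬ Sim (items s) x y)
proposition4 _ _ _ _ open-s (inj₁ closed-s) = ⊥-elim (open-s closed-s)
proposition4 _ _ _ _ _      (inj₂ terminal) =
  Sim-isEquivalence (terminal⇒eqRule-closed terminal)
  , Sim-pos-neg-disjoint (terminal⇒¬closurePremise terminal)
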